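{- Consider placing balls independently and uniformly at random into $B$ bins, once with $M(B)$ balls and once with $M'(B)$ balls, where $M'(B)=\omega(M(B))$ as $B\to\infty$. If, for some $s\ge1$, the maximum load for $M(B)$ balls is at least $s$ with probability bounded away from $0$, then the maximum load for $M'(B)$ balls is at least $s$ w.h.p.
   Context: The maximum load is the maximum number of balls in any bin. W.h.p. means with probability tending to $1$ as $B\to\infty$; "bounded away from $0$" means $\liminf>0$; $M'=\omega(M)$ means $M/M'\to0$. -}

module Defs where

open import Data.Nat using (ℕ; zero; suc; _⊔_; _≤?_)
open import Data.Fin using (Fin) renaming (_≟_ to _≟ᶠ_)
open import Data.List using (List; []; _∷_; map; concatMap; filter; length; foldr; allFin)
open import Data.Vec.Functional using () renaming (_∷_ to _∷ᶠ_)
open import Data.Integer using (+_)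
open import Data.Rational using (ℚ; 0ℚ; _/_)

-- All assignments of m (labelled) balls to b bins: the uniform sample space,
-- listed without repetition (it has b ^ m elements).
allAssignments : (m b : ℕ) → List (Fin m → Fin b)
allAssignments zero    b = (λ ()) ∷ []
allAssignments (suc m) b =
  concatMap (λ f → map (λ j → j ∷ᶠ f) (allFin b)) (allAssignments m b)

load : {m b : ℕ} → (Fin m → Fin b) → Fin b → ℕ
load {m} f j = length (filter (λ i → f i ≟ᶠ j) (allFin m))

maxLoad : {m b : ℕ} → (Fin m → Fin b) → ℕ
maxLoad {m} {b} f = foldr _⊔_ 0 (map (load f) (allFin b))

countMaxLoadAtLeast : (m b s : ℕ) → ℕ
countMaxLoadAtLeast m b s =
  length (filter (λ f → s ≤? maxLoad f) (allAssignments m b))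

private
  ratio : ℕ → ℕ → ℚ
  ratio c zero    = 0ℚ
  ratio c (suc n) = (+ c) / suc n

-- Pr[ max load ≥ s ] when m balls are thrown independently and uniformly
-- into b bins (uniform measure on all b^m assignments). Convention: 0 if b = 0, m > 0
-- (empty sample space; irrelevant as b → ∞).
probMaxLoadAtLeast : (m b s : ℕ) → ℚ
probMaxLoadAtLeast m b s =
  ratio (countMaxLoadAtLeast m b s) (length (allAssignments m b))

toℚ : ℕ → ℚ
toℚ n = (+ n) / 1

module Submission where

-- Call an assignment of balls to b bins bad if its maximum load is < s.
-- Splitting m₁ + m₂ balls into a first block of m₁ and a second block of m₂
-- balls, an assignment can only be bad if both blocks are bad; summing over
-- the product sample space gives  #bad (m₁ + m₂) ≤ #bad m₁ * #bad m₂.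
-- If at least a fraction 1/(x+1) of the M-ball assignments is good, the bad
-- fraction at M is at most (x+1)/(x+2), hence at most ((x+1)/(x+2))^k at
-- any M' ≥ k M; by Bernoulli's inequality this is ≤ 1/d for k = d (x+1).
-- Since M' = ω(M), M' ≥ d (x+1) M holds for all large B, for every d.

module Amplification where

  open import Data.Nat
  open import Data.Nat.Properties
  open import Data.Nat.Tactic.RingSolver using (solve-∀)
  open import Relation.Binary.PropositionalEquality

  complement-bound : ∀ x {g β t} → g + β ≡ t → t ≤ g * x → suc x * β ≤ x * t
  complement-bound x {g} {β} {t} g+β≡t t≤gx = +-cancelˡ-≤ t _ _ (begin
    t + suc x * β          ≤⟨ +-monoˡ-≤ (suc x * β) (≤-trans t≤gx (*-monoʳ-≤ g (n≤1+n x))) ⟩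
    g * suc x + suc x * β  ≡⟨ cong (_+ suc x * β) (*-comm g (suc x)) ⟩
    suc x * g + suc x * β  ≡⟨ sym (*-distribˡ-+ (suc x) g β) ⟩
    suc x * (g + β)        ≡⟨ cong (suc x *_) g+β≡t ⟩
    suc x * t              ∎)
    where open ≤-Reasoning

  amplify : (β : ℕ → ℕ) (b : ℕ) → (∀ m n → β (m + n) ≤ β m * β n) → (∀ m → β m ≤ b ^ m) →
            ∀ {m x} → suc x * β m ≤ x * b ^ m →
            ∀ k {m'} → k * m ≤ m' → suc x ^ k * β m' ≤ x ^ k * b ^ m'
  amplify β b submult bounded {m} {x} base k {m'} km≤m' =
    subst (λ n → suc x ^ k * β n ≤ x ^ k * b ^ n) (m+[n∸m]≡n km≤m') (blocks k (m' ∸ k * m))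
    where
    swap : ∀ p q r u → (p * q) * (r * u) ≡ (p * r) * (q * u)
    swap = solve-∀
    -- k blocks of m balls followed by a remainder of r balls
    blocks : ∀ k r → suc x ^ k * β (k * m + r) ≤ x ^ k * b ^ (k * m + r)
    blocks zero    r = *-monoʳ-≤ 1 (bounded r)
    blocks (suc k) r rewrite +-assoc m (k * m) r = begin
      (suc x * suc x ^ k) * β (m + n)        ≤⟨ *-monoʳ-≤ (suc x * suc x ^ k) (submult m n) ⟩
      (suc x * suc x ^ k) * (β m * β n)      ≡⟨ swap (suc x) (suc x ^ k) (β m) (β n) ⟩
      (suc x * β m) * (suc x ^ k * β n)      ≤⟨ *-mono-≤ base (blocks k r) ⟩
      (x * b ^ m) * (x ^ k * b ^ n)          ≡⟨ swap x (b ^ m) (x ^ k) (b ^ n) ⟩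
      (x * x ^ k) * (b ^ m * b ^ n)          ≡⟨ cong ((x * x ^ k) *_) (sym (^-distribˡ-+-* b m n)) ⟩
      (x * x ^ k) * b ^ (m + n)              ∎
      where
      open ≤-Reasoning
      n : ℕ
      n = k * m + r

  bernoulli : ∀ x k → (x + k) * x ^ k ≤ x * suc x ^ k
  bernoulli x zero    = ≤-reflexive (cong (_* 1) (+-identityʳ x))
  bernoulli x (suc k) = begin
    (x + suc k) * (x * x ^ k)                ≤⟨ m≤m+n _ (k * x ^ k) ⟩
    (x + suc k) * (x * x ^ k) + k * x ^ k    ≡⟨ expand x k (x ^ k) ⟩
    suc x * ((x + k) * x ^ k)                ≤⟨ *-monoʳ-≤ (suc x) (bernoulli x k) ⟩
    suc x * (x * suc x ^ k)                  ≡⟨ reassociate x (suc x ^ k) ⟩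
    x * (suc x * suc x ^ k)                  ∎
    where
    open ≤-Reasoning
    expand : ∀ x k a → (x + suc k) * (x * a) + k * a ≡ suc x * ((x + k) * a)
    expand = solve-∀
    reassociate : ∀ x a → suc x * (x * a) ≡ x * (suc x * a)
    reassociate = solve-∀

  -- By Bernoulli, (y/(y+1))^(d y) ≤ 1/d for y = x + 1 ≥ 1; so a ratio bound
  -- β/t ≤ (y/(y+1))^(d y) implies the ratio bound β/t ≤ 1/d.
  decay : ∀ x d {β t} → suc (suc x) ^ (d * suc x) * β ≤ suc x ^ (d * suc x) * t → d * β ≤ t
  decay x' d {β} {t} le = *-cancelˡ-≤ (x * suc x ^ k) {{m*n≢0 x (suc x ^ k) {{_}} {{m^n≢0 (suc x) k}}}} (begin
    (x * suc x ^ k) * (d * β)   ≡⟨ swap x (suc x ^ k) d β ⟩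
    (d * x) * (suc x ^ k * β)   ≤⟨ *-monoʳ-≤ (d * x) le ⟩
    (d * x) * (x ^ k * t)       ≡⟨ sym (*-assoc (d * x) (x ^ k) t) ⟩
    ((d * x) * x ^ k) * t       ≤⟨ *-monoˡ-≤ t (*-monoˡ-≤ (x ^ k) (m≤n+m (d * x) x)) ⟩
    ((x + d * x) * x ^ k) * t   ≤⟨ *-monoˡ-≤ t (bernoulli x k) ⟩
    (x * suc x ^ k) * t         ∎)
    where
    open ≤-Reasoning
    x k : ℕ
    x = suc x'
    k = d * x
    swap : ∀ x a d β → (x * a) * (d * β) ≡ (d * x) * (a * β)
    swap = solve-∀

module Counting where

  open import Defs using (allAssignments; load; maxLoad; countMaxLoadAtLeast)
  open import Data.Nat
  open import Data.Nat.Properties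
  open import Data.Nat.Tactic.RingSolver using (solve-∀)
  open import Data.Bool using (Bool; true; false; not)
  open import Data.Fin using (Fin; zero; suc; splitAt) renaming (_≟_ to _≟ᶠ_)
  open import Data.List using (List; []; _∷_; map; concatMap; filter; length; foldr; allFin)
    renaming (_++_ to _++ˡ_)
  open import Data.List.Properties using (map-tabulate; length-tabulate)
  open import Data.Vec.Functional using () renaming (_∷_ to _∷ᶠ_; _++_ to _++ᶠ_)
  open import Data.Sum using (inj₁; inj₂)
  open import Function using (id; _∘_)
  open import Level using (Level)
  open import Relation.Nullary using (does; yes; no; ¬_)
  open import Relation.Nullary.Decidable using (dec-true; dec-false)
  open import Relation.Unary using (Pred; Decidable)
  open import Relation.Binary.PropositionalEquality
  open Amplification using (complement-bound; amplify; decay)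

  ∑ : {X : Set} → List X → (X → ℕ) → ℕ
  ∑ []       w = 0
  ∑ (x ∷ xs) w = w x + ∑ xs w

  ∑-++ : {X : Set} (xs ys : List X) (w : X → ℕ) → ∑ (xs ++ˡ ys) w ≡ ∑ xs w + ∑ ys w
  ∑-++ []       ys w = refl
  ∑-++ (x ∷ xs) ys w = trans (cong (w x +_) (∑-++ xs ys w)) (sym (+-assoc (w x) _ _))

  ∑-map : {X Y : Set} (f : X → Y) (xs : List X) (w : Y → ℕ) → ∑ (map f xs) w ≡ ∑ xs (w ∘ f)
  ∑-map f []       w = refl
  ∑-map f (x ∷ xs) w = cong (w (f x) +_) (∑-map f xs w)

  ∑-concatMap : {X Y : Set} (f : X → List Y) (xs : List X) (w : Y → ℕ) →
                ∑ (concatMap f xs) w ≡ ∑ xs (λ x → ∑ (f x) w)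
  ∑-concatMap f []       w = refl
  ∑-concatMap f (x ∷ xs) w =
    trans (∑-++ (f x) (concatMap f xs) w) (cong (∑ (f x) w +_) (∑-concatMap f xs w))

  ∑-cong : {X : Set} (xs : List X) {w v : X → ℕ} → (∀ x → w x ≡ v x) → ∑ xs w ≡ ∑ xs v
  ∑-cong []       e = refl
  ∑-cong (x ∷ xs) e = cong₂ _+_ (e x) (∑-cong xs e)

  ∑-mono : {X : Set} (xs : List X) {w v : X → ℕ} → (∀ x → w x ≤ v x) → ∑ xs w ≤ ∑ xs v
  ∑-mono []       e = z≤n
  ∑-mono (x ∷ xs) e = +-mono-≤ (e x) (∑-mono xs e)

  ∑-+ : {X : Set} (xs : List X) (w v : X → ℕ) → ∑ xs (λ x → w x + v x) ≡ ∑ xs w + ∑ xs v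
  ∑-+ []       w v = refl
  ∑-+ (x ∷ xs) w v =
    trans (cong (w x + v x +_) (∑-+ xs w v)) (interchange (w x) (v x) (∑ xs w) (∑ xs v))
    where
    interchange : ∀ a b c d → a + b + (c + d) ≡ a + c + (b + d)
    interchange = solve-∀

  ∑-*ˡ : {X : Set} (xs : List X) (c : ℕ) (w : X → ℕ) → ∑ xs (λ x → c * w x) ≡ c * ∑ xs w
  ∑-*ˡ []       c w = sym (*-zeroʳ c)
  ∑-*ˡ (x ∷ xs) c w =
    trans (cong (c * w x +_) (∑-*ˡ xs c w)) (sym (*-distribˡ-+ c (w x) (∑ xs w)))

  ∑-*ʳ : {X : Set} (xs : List X) (c : ℕ) (w : X → ℕ) → ∑ xs (λ x → w x * c) ≡ ∑ xs w * c
  ∑-*ʳ xs c w = trans (∑-cong xs (λ x → *-comm (w x) c)) (trans (∑-*ˡ xs c w) (*-comm c _))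

  ∑-allFin-suc : ∀ n (w : Fin (suc n) → ℕ) → ∑ (allFin (suc n)) w ≡ w zero + ∑ (allFin n) (w ∘ suc)
  ∑-allFin-suc n w =
    cong (w zero +_) (trans (cong (λ xs → ∑ xs w) (sym (map-tabulate id suc))) (∑-map suc (allFin n) w))

  length-as-∑ : {X : Set} (xs : List X) → length xs ≡ ∑ xs (λ _ → 1)
  length-as-∑ []       = refl
  length-as-∑ (x ∷ xs) = cong suc (length-as-∑ xs)

  ∑-allFin-1 : ∀ n → ∑ (allFin n) (λ _ → 1) ≡ n
  ∑-allFin-1 n = trans (sym (length-as-∑ (allFin n))) (length-tabulate id)

  indicator : Bool → ℕ
  indicator true  = 1
  indicator false = 0

  indicator-not : ∀ x → indicator x + indicator (not x) ≡ 1
  indicator-not true  = refl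
  indicator-not false = refl

  length-filter : {X : Set} {p : Level} {P : Pred X p} (P? : Decidable P) (xs : List X) →
                  length (filter P? xs) ≡ ∑ xs (λ x → indicator (does (P? x)))
  length-filter P? []       = refl
  length-filter P? (x ∷ xs) with does (P? x)
  ... | true  = cong suc (length-filter P? xs)
  ... | false = length-filter P? xs

  ++-tail : {A : Set} {m n : ℕ} (g : Fin (suc m) → A) (h : Fin n → A) (i : Fin (m + n)) →
            (g ++ᶠ h) (suc i) ≡ ((g ∘ suc) ++ᶠ h) i
  ++-tail {m = m} g h i with splitAt m i
  ... | inj₁ _ = refl
  ... | inj₂ _ = refl

  ∷-++ : {A : Set} {m n : ℕ} (j : A) (g : Fin m → A) (h : Fin n → A) (i : Fin (suc (m + n))) →
         (j ∷ᶠ (g ++ᶠ h)) i ≡ ((j ∷ᶠ g) ++ᶠ h) i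
  ∷-++ j g h zero    = refl
  ∷-++ j g h (suc i) = sym (++-tail (j ∷ᶠ g) h i)

  ∷-cong : {A : Set} {m : ℕ} (j : A) {f g : Fin m → A} → (∀ i → f i ≡ g i) →
           ∀ i → (j ∷ᶠ f) i ≡ (j ∷ᶠ g) i
  ∷-cong j e zero    = refl
  ∷-cong j e (suc i) = e i

  ballSum : {m b : ℕ} → (Fin b → ℕ) → (Fin m → Fin b) → ℕ
  ballSum {m} e f = ∑ (allFin m) (λ i → e (f i))

  ballSum-++ : ∀ m₁ {m₂ b} (e : Fin b → ℕ) (g : Fin m₁ → Fin b) (h : Fin m₂ → Fin b) →
               ballSum e (g ++ᶠ h) ≡ ballSum e g + ballSum e h
  ballSum-++ zero    e g h = refl
  ballSum-++ (suc m₁) {m₂} e g h = begin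
    ballSum e (g ++ᶠ h)                        ≡⟨ ∑-allFin-suc (m₁ + m₂) _ ⟩
    e (g zero) + ∑ (allFin (m₁ + m₂)) (λ i → e ((g ++ᶠ h) (suc i)))
      ≡⟨ cong (e (g zero) +_) (∑-cong (allFin _) (λ i → cong e (++-tail g h i))) ⟩
    e (g zero) + ballSum e ((g ∘ suc) ++ᶠ h)   ≡⟨ cong (e (g zero) +_) (ballSum-++ m₁ e (g ∘ suc) h) ⟩
    e (g zero) + (ballSum e (g ∘ suc) + ballSum e h)
      ≡⟨ sym (+-assoc (e (g zero)) _ _) ⟩
    e (g zero) + ballSum e (g ∘ suc) + ballSum e h
      ≡⟨ cong (_+ ballSum e h) (sym (∑-allFin-suc m₁ (λ i → e (g i)))) ⟩
    ballSum e g + ballSum e h                  ∎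
    where open ≡-Reasoning

  inBin : {b : ℕ} → Fin b → Fin b → ℕ
  inBin j k = indicator (does (k ≟ᶠ j))

  load-as-ballSum : {m b : ℕ} (f : Fin m → Fin b) (j : Fin b) → load f j ≡ ballSum (inBin j) f
  load-as-ballSum {m} f j = length-filter (λ i → f i ≟ᶠ j) (allFin m)

  load-++ : ∀ {m₁ m₂ b} (g : Fin m₁ → Fin b) (h : Fin m₂ → Fin b) (j : Fin b) →
            load (g ++ᶠ h) j ≡ load g j + load h j
  load-++ {m₁} g h j = begin
    load (g ++ᶠ h) j                 ≡⟨ load-as-ballSum (g ++ᶠ h) j ⟩
    ballSum (inBin j) (g ++ᶠ h)                  ≡⟨ ballSum-++ m₁ (inBin j) g h ⟩
    ballSum (inBin j) g + ballSum (inBin j) h    ≡⟨ sym (cong₂ _+_ (load-as-ballSum g j) (load-as-ballSum h j)) ⟩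
    load g j + load h j              ∎
    where open ≡-Reasoning

  load-cong : ∀ {m b} {f g : Fin m → Fin b} → (∀ i → f i ≡ g i) → ∀ j → load f j ≡ load g j
  load-cong {m} {f = f} {g} e j = begin
    load f j                               ≡⟨ load-as-ballSum f j ⟩
    ballSum (inBin j) f                    ≡⟨ ∑-cong (allFin m) (λ i → cong (inBin j) (e i)) ⟩
    ballSum (inBin j) g                    ≡⟨ sym (load-as-ballSum g j) ⟩
    load g j                               ∎
    where open ≡-Reasoning

  maxLoad-mono : ∀ {m n b} (f : Fin m → Fin b) (g : Fin n → Fin b) →
                 (∀ j → load f j ≤ load g j) → maxLoad f ≤ maxLoad g
  maxLoad-mono {b = b} f g le = max-mono (allFin b)
    where
    max-mono : (js : List (Fin b)) → foldr _⊔_ 0 (map (load f) js) ≤ foldr _⊔_ 0 (map (load g) js)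
    max-mono []       = z≤n
    max-mono (j ∷ js) = ⊔-mono-≤ (le j) (max-mono js)

  maxLoad-cong : ∀ {m b} (f g : Fin m → Fin b) → (∀ i → f i ≡ g i) → maxLoad f ≡ maxLoad g
  maxLoad-cong f g e = ≤-antisym (maxLoad-mono f g (λ j → ≤-reflexive (load-cong e j)))
                                 (maxLoad-mono g f (λ j → ≤-reflexive (sym (load-cong e j))))

  maxLoad-++ˡ : ∀ {m₁ m₂ b} (g : Fin m₁ → Fin b) (h : Fin m₂ → Fin b) → maxLoad g ≤ maxLoad (g ++ᶠ h)
  maxLoad-++ˡ g h = maxLoad-mono g (g ++ᶠ h) (λ j → subst (load g j ≤_) (sym (load-++ g h j)) (m≤m+n _ _))

  maxLoad-++ʳ : ∀ {m₁ m₂ b} (g : Fin m₁ → Fin b) (h : Fin m₂ → Fin b) → maxLoad h ≤ maxLoad (g ++ᶠ h)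
  maxLoad-++ʳ g h = maxLoad-mono h (g ++ᶠ h) (λ j → subst (load h j ≤_) (sym (load-++ g h j)) (m≤n+m _ _))

  module SampleSpace (b : ℕ) where

    ∑Ω : ∀ m → ((Fin m → Fin b) → ℕ) → ℕ
    ∑Ω m w = ∑ (allAssignments m b) w

    ∑Ω-suc : ∀ m w → ∑Ω (suc m) w ≡ ∑Ω m (λ f → ∑ (allFin b) (λ j → w (j ∷ᶠ f)))
    ∑Ω-suc m w = trans (∑-concatMap _ (allAssignments m b) w)
                       (∑-cong (allAssignments m b) (λ f → ∑-map (_∷ᶠ f) (allFin b) w))

    size-Ω : ∀ m → ∑Ω m (λ _ → 1) ≡ b ^ m
    size-Ω zero    = refl
    size-Ω (suc m) = begin
      ∑Ω (suc m) (λ _ → 1)                ≡⟨ ∑Ω-suc m (λ _ → 1) ⟩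
      ∑Ω m (λ _ → ∑ (allFin b) (λ _ → 1))
        ≡⟨ ∑-cong (allAssignments m b) (λ _ → trans (∑-allFin-1 b) (sym (*-identityʳ b))) ⟩
      ∑Ω m (λ _ → b * 1)                  ≡⟨ ∑-*ˡ (allAssignments m b) b (λ _ → 1) ⟩
      b * ∑Ω m (λ _ → 1)                  ≡⟨ cong (b *_) (size-Ω m) ⟩
      b * b ^ m                           ∎
      where open ≡-Reasoning

    length-Ω : ∀ m → length (allAssignments m b) ≡ b ^ m
    length-Ω m = trans (length-as-∑ (allAssignments m b)) (size-Ω m)

    -- Product structure: an assignment of m₁ + m₂ balls is the concatenation
    -- of assignments of the two blocks.  So a weight dominated on
    -- concatenations by a product of weights has total at most the product
    -- of the totals.  (The weight w must respect pointwise equality, since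
    -- prepending a ball does not commute with concatenation definitionally.)
    ∑Ω-product : ∀ m₁ {m₂} (w : (Fin (m₁ + m₂) → Fin b) → ℕ)
                 (u : (Fin m₁ → Fin b) → ℕ) (v : (Fin m₂ → Fin b) → ℕ) →
                 (∀ f f' → (∀ i → f i ≡ f' i) → w f ≡ w f') →
                 (∀ g h → w (g ++ᶠ h) ≤ u g * v h) →
                 ∑Ω (m₁ + m₂) w ≤ ∑Ω m₁ u * ∑Ω m₂ v
    ∑Ω-product zero {m₂} w u v _ dom = begin
      ∑Ω m₂ w                                   ≤⟨ ∑-mono (allAssignments m₂ b) (dom (λ ())) ⟩
      ∑Ω m₂ (λ h → u (λ ()) * v h)              ≡⟨ ∑-*ˡ (allAssignments m₂ b) (u (λ ())) v ⟩
      u (λ ()) * ∑Ω m₂ v                        ≡⟨ cong (_* ∑Ω m₂ v) (sym (+-identityʳ (u (λ ())))) ⟩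
      ∑Ω zero u * ∑Ω m₂ v                       ∎
      where open ≤-Reasoning
    ∑Ω-product (suc m₁) {m₂} w u v w-cong dom = begin
      ∑Ω (suc (m₁ + m₂)) w       ≡⟨ ∑Ω-suc (m₁ + m₂) w ⟩
      ∑Ω (m₁ + m₂) w₁            ≤⟨ ∑Ω-product m₁ w₁ u₁ v w₁-cong dom₁ ⟩
      ∑Ω m₁ u₁ * ∑Ω m₂ v         ≡⟨ cong (_* ∑Ω m₂ v) (sym (∑Ω-suc m₁ u)) ⟩
      ∑Ω (suc m₁) u * ∑Ω m₂ v    ∎
      where
      open ≤-Reasoning
      w₁ : (Fin (m₁ + m₂) → Fin b) → ℕ
      w₁ f = ∑ (allFin b) (λ j → w (j ∷ᶠ f))
      u₁ : (Fin m₁ → Fin b) → ℕ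
      u₁ g = ∑ (allFin b) (λ j → u (j ∷ᶠ g))
      w₁-cong : ∀ f f' → (∀ i → f i ≡ f' i) → w₁ f ≡ w₁ f'
      w₁-cong f f' e = ∑-cong (allFin b) (λ j → w-cong _ _ (∷-cong j e))
      dom₁ : ∀ g h → w₁ (g ++ᶠ h) ≤ u₁ g * v h
      dom₁ g h = ≤-trans
        (∑-mono (allFin b) (λ j → subst (_≤ u (j ∷ᶠ g) * v h)
                                        (w-cong _ _ (λ i → sym (∷-++ j g h i))) (dom (j ∷ᶠ g) h)))
        (≤-reflexive (∑-*ʳ (allFin b) (v h) (λ j → u (j ∷ᶠ g))))

    module Threshold (s : ℕ) where

      good bad : ∀ {m} → (Fin m → Fin b) → ℕ
      good f = indicator (does (s ≤? maxLoad f))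
      bad  f = indicator (not (does (s ≤? maxLoad f)))

      #good #bad : ℕ → ℕ
      #good m = ∑Ω m good
      #bad  m = ∑Ω m bad

      #good+#bad : ∀ m → #good m + #bad m ≡ b ^ m
      #good+#bad m = begin
        #good m + #bad m   ≡⟨ sym (∑-+ (allAssignments m b) good bad) ⟩
        ∑Ω m (λ f → good f + bad f)
          ≡⟨ ∑-cong (allAssignments m b) (λ f → indicator-not (does (s ≤? maxLoad f))) ⟩
        ∑Ω m (λ _ → 1)     ≡⟨ size-Ω m ⟩
        b ^ m              ∎
        where open ≡-Reasoning

      #bad≤total : ∀ m → #bad m ≤ b ^ m
      #bad≤total m = subst (#bad m ≤_) (#good+#bad m) (m≤n+m (#bad m) (#good m))

      count≡#good : ∀ m → countMaxLoadAtLeast m b s ≡ #good m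
      count≡#good m = length-filter (λ f → s ≤? maxLoad f) (allAssignments m b)

      bad-cong : ∀ {m} (f f' : Fin m → Fin b) → (∀ i → f i ≡ f' i) → bad f ≡ bad f'
      bad-cong f f' e = cong (λ l → indicator (not (does (s ≤? l)))) (maxLoad-cong f f' e)

      bad≡0 : ∀ {m} (f : Fin m → Fin b) → s ≤ maxLoad f → bad f ≡ 0
      bad≡0 f big = cong (indicator ∘ not) (dec-true (s ≤? maxLoad f) big)

      bad≡1 : ∀ {m} (f : Fin m → Fin b) → ¬ s ≤ maxLoad f → bad f ≡ 1
      bad≡1 f small = cong (indicator ∘ not) (dec-false (s ≤? maxLoad f) small)

      bad-++ : ∀ {m₁ m₂} (g : Fin m₁ → Fin b) (h : Fin m₂ → Fin b) → bad (g ++ᶠ h) ≤ bad g * bad h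
      bad-++ g h with s ≤? maxLoad (g ++ᶠ h)
      ... | yes big   rewrite bad≡0 (g ++ᶠ h) big = z≤n
      ... | no  small rewrite bad≡1 (g ++ᶠ h) small
                            | bad≡1 g (λ big → small (≤-trans big (maxLoad-++ˡ g h)))
                            | bad≡1 h (λ big → small (≤-trans big (maxLoad-++ʳ g h))) = ≤-refl

      #bad-submultiplicative : ∀ m n → #bad (m + n) ≤ #bad m * #bad n
      #bad-submultiplicative m n = ∑Ω-product m bad bad bad bad-cong bad-++

      bad-fraction-decays : ∀ {m m'} x d → b ^ m ≤ #good m * suc x → d * suc x * m ≤ m' →
                            d * #bad m' ≤ b ^ m'
      bad-fraction-decays {m} x d enough-good many-balls =
        decay x d (amplify #bad b #bad-submultiplicative #bad≤total bad-at-m (d * suc x) many-balls)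
        where
        bad-at-m : suc (suc x) * #bad m ≤ suc x * b ^ m
        bad-at-m = complement-bound (suc x) {#good m} {#bad m} (#good+#bad m) enough-good

module Fractions where

  open import Data.Nat as ℕ using (ℕ; suc)
  import Data.Nat.Properties as ℕ
  open import Data.Integer as ℤ using (ℤ; +_; +[1+_]; -[1+_]; 1ℤ)
  import Data.Integer.Properties as ℤ
  open import Data.Integer.Tactic.RingSolver using (solve-∀)
  open import Data.Rational using (ℚ; mkℚ; 0ℚ; 1ℚ; _≤_; _<_; _*_; _-_; -_; _/_; toℚᵘ; positive)
  open import Data.Rational.Properties
    using (toℚᵘ-mono-≤; toℚᵘ-cancel-≤; toℚᵘ-fromℚᵘ; toℚᵘ-injective; toℚᵘ-homo-+; toℚᵘ-homo-*;
           toℚᵘ-homo‿-; ↥p/↧p≡p; positive⁻¹; normalize-pos)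
  open import Data.Rational.Unnormalised as ℚᵘ using (mkℚᵘ; *≤*; *≡*)
  import Data.Rational.Unnormalised.Properties as ℚᵘ
  open import Data.Product using (∃; _,_)
  open import Relation.Binary.PropositionalEquality
  open import Defs using (toℚ)

  frac : ℕ → ℕ → ℚ
  frac a t = (+ a) / suc t

  toℚᵘ-frac : ∀ a t → toℚᵘ (frac a t) ℚᵘ.≃ mkℚᵘ (+ a) t
  toℚᵘ-frac a t = toℚᵘ-fromℚᵘ (mkℚᵘ (+ a) t)

  frac-positive : ∀ k → 0ℚ < frac 1 k
  frac-positive k = positive⁻¹ (frac 1 k) {{normalize-pos 1 (suc k)}}

  frac-≤⇒ : ∀ a t c u → frac a t ≤ frac c u → a ℕ.* suc u ℕ.≤ c ℕ.* suc t
  frac-≤⇒ a t c u le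
    with ℚᵘ.≤-respʳ-≃ (toℚᵘ-frac c u) (ℚᵘ.≤-respˡ-≃ (toℚᵘ-frac a t) (toℚᵘ-mono-≤ le))
  ... | *≤* cross = ℤ.drop‿+≤+ (subst₂ ℤ._≤_ (sym (ℤ.pos-* a (suc u))) (sym (ℤ.pos-* c (suc t))) cross)

  frac-≤⇐ : ∀ a t c u → a ℕ.* suc u ℕ.≤ c ℕ.* suc t → frac a t ≤ frac c u
  frac-≤⇐ a t c u le = toℚᵘ-cancel-≤
    (ℚᵘ.≤-respʳ-≃ (ℚᵘ.≃-sym (toℚᵘ-frac c u)) (ℚᵘ.≤-respˡ-≃ (ℚᵘ.≃-sym (toℚᵘ-frac a t))
      (*≤* (subst₂ ℤ._≤_ (ℤ.pos-* a (suc u)) (ℤ.pos-* c (suc t)) (ℤ.+≤+ le)))))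

  unit-fraction-below : ∀ q → 0ℚ < q → ∃ λ n → frac 1 n ≤ q
  unit-fraction-below q@(mkℚ +[1+ a ] n _) _ =
    n , subst (frac 1 n ≤_) (↥p/↧p≡p q)
              (frac-≤⇐ 1 n (suc a) n (ℕ.*-monoˡ-≤ (suc n) {1} {suc a} (ℕ.s≤s ℕ.z≤n)))
  unit-fraction-below (mkℚ (+ 0) _ _) 0<q with positive 0<q
  ... | ()
  unit-fraction-below (mkℚ -[1+ _ ] _ _) 0<q with positive 0<q
  ... | ()

  frac-scale : ∀ k m → frac 1 k * toℚ m ≡ frac m k
  frac-scale k m = toℚᵘ-injective (begin
    toℚᵘ (frac 1 k * toℚ m)              ≈⟨ toℚᵘ-homo-* (frac 1 k) (toℚ m) ⟩
    toℚᵘ (frac 1 k) ℚᵘ.* toℚᵘ (toℚ m)    ≈⟨ ℚᵘ.*-cong (toℚᵘ-frac 1 k) (toℚᵘ-frac m 0) ⟩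
    mkℚᵘ (+ 1) k ℚᵘ.* mkℚᵘ (+ m) 0       ≈⟨ *≡* cross ⟩
    mkℚᵘ (+ m) k                         ≈⟨ ℚᵘ.≃-sym (toℚᵘ-frac m k) ⟩
    toℚᵘ (frac m k)                      ∎)
    where
    open ℚᵘ.≃-Reasoning
    cross : (1ℤ ℤ.* + m) ℤ.* + suc k ≡ + m ℤ.* + (suc k ℕ.* 1)
    cross = cong₂ ℤ._*_ (ℤ.*-identityˡ (+ m)) (cong +_ (sym (ℕ.*-identityʳ (suc k))))

  frac-complement : ∀ {a c t} → a ℕ.+ c ≡ suc t → 1ℚ - frac c t ≡ frac a t
  frac-complement {a} {c} {t} a+c≡1+t = toℚᵘ-injective (begin
    toℚᵘ (1ℚ - frac c t)                      ≈⟨ toℚᵘ-homo-+ 1ℚ (- frac c t) ⟩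
    toℚᵘ 1ℚ ℚᵘ.+ toℚᵘ (- frac c t)            ≈⟨ ℚᵘ.+-congʳ (toℚᵘ 1ℚ) (toℚᵘ-homo‿- (frac c t)) ⟩
    toℚᵘ 1ℚ ℚᵘ.- toℚᵘ (frac c t)              ≈⟨ ℚᵘ.+-congʳ (toℚᵘ 1ℚ) (ℚᵘ.-‿cong (toℚᵘ-frac c t)) ⟩
    toℚᵘ 1ℚ ℚᵘ.- mkℚᵘ (+ c) t                 ≈⟨ *≡* cross ⟩
    mkℚᵘ (+ a) t                              ≈⟨ ℚᵘ.≃-sym (toℚᵘ-frac a t) ⟩
    toℚᵘ (frac a t)                           ∎)
    where
    open ℚᵘ.≃-Reasoning
    -- the cross-multiplied identity, after writing t + 1 as a + c
    complement-ℤ : ∀ (a c T : ℤ) → a ℤ.+ c ≡ T → (1ℤ ℤ.* T ℤ.+ ℤ.- c ℤ.* 1ℤ) ℤ.* T ≡ a ℤ.* T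
    complement-ℤ a c _ refl = identity a c
      where
      identity : ∀ (a c : ℤ) →
                 (1ℤ ℤ.* (a ℤ.+ c) ℤ.+ ℤ.- c ℤ.* 1ℤ) ℤ.* (a ℤ.+ c) ≡ a ℤ.* (a ℤ.+ c)
      identity = solve-∀
    cross : (1ℤ ℤ.* + suc t ℤ.+ ℤ.- (+ c) ℤ.* 1ℤ) ℤ.* + suc t ≡ + a ℤ.* + (1 ℕ.* suc t)
    cross = trans (complement-ℤ (+ a) (+ c) (+ suc t) (trans (sym (ℤ.pos-+ a c)) (cong +_ a+c≡1+t)))
                  (cong (λ n → + a ℤ.* + n) (sym (ℕ.*-identityˡ (suc t))))

  ≤-scaled⇒ : ∀ {k m m'} → toℚ m ≤ frac 1 k * toℚ m' → suc k ℕ.* m ℕ.≤ m'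
  ≤-scaled⇒ {k} {m} {m'} le = subst₂ ℕ._≤_ (ℕ.*-comm m (suc k)) (ℕ.*-identityʳ m')
    (frac-≤⇒ m 0 m' k (subst (toℚ m ≤_) (frac-scale k m') le))

open import Defs
open import Data.Nat as ℕ using (ℕ; suc; _⊔_; s≤s) renaming (_≥_ to _≥ⁿ_)
open import Data.Nat.Properties using (m≤m⊔n; m≤n⊔m; n≤1+n; ≤-trans)
open import Data.Product using (∃; _×_; _,_; proj₁; proj₂)
open import Data.Rational using (ℚ; 0ℚ; 1ℚ; _≤_; _<_; _*_; _-_)
import Data.Rational.Properties as ℚ

module Probability (b s : ℕ) where

  open import Data.Nat using (_^_; pred)
  open import Data.Nat.Properties using (suc-pred; m^n≢0; *-identityˡ; *-comm)
  open import Data.List using (length)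
  open import Relation.Binary.PropositionalEquality
  open Counting using (module SampleSpace)
  open SampleSpace (suc b)
  open Threshold s
  open Fractions

  probability-as-fraction : ∀ m → ∃ λ t → suc t ≡ suc b ^ m ×
                                          probMaxLoadAtLeast m (suc b) s ≡ frac (#good m) t
  probability-as-fraction m = t , size≡ , with-size (trans (length-Ω m) (sym size≡))
    where
    t : ℕ
    t = pred (suc b ^ m)
    size≡ : suc t ≡ suc b ^ m
    size≡ = suc-pred (suc b ^ m) {{m^n≢0 (suc b) m}}
    with-size : length (allAssignments m (suc b)) ≡ suc t →
                probMaxLoadAtLeast m (suc b) s ≡ frac (#good m) t
    with-size eq rewrite eq = cong (λ g → frac g t) (count≡#good m)

  probability⇒many-good : ∀ {m x} → frac 1 x ≤ probMaxLoadAtLeast m (suc b) s →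
                          suc b ^ m ℕ.≤ #good m ℕ.* suc x
  probability⇒many-good {m} {x} le with probability-as-fraction m
  ... | t , size≡ , prob≡ = subst (ℕ._≤ #good m ℕ.* suc x) (trans (*-identityˡ (suc t)) size≡)
                                  (frac-≤⇒ 1 x (#good m) t (subst (frac 1 x ≤_) prob≡ le))

  few-bad⇒high-probability : ∀ {m d ε} → frac 1 d ≤ ε → suc d ℕ.* #bad m ℕ.≤ suc b ^ m →
                             1ℚ - ε ≤ probMaxLoadAtLeast m (suc b) s
  few-bad⇒high-probability {m} {d} {ε} 1/d≤ε few-bad with probability-as-fraction m
  ... | t , size≡ , prob≡ =
    subst (1ℚ - ε ≤_) (trans (frac-complement {#good m} {#bad m} {t} good+bad≡size) (sym prob≡))
          (ℚ.+-monoʳ-≤ 1ℚ (ℚ.neg-antimono-≤ (ℚ.≤-trans bad≤1/d 1/d≤ε)))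
    where
    good+bad≡size : #good m ℕ.+ #bad m ≡ suc t
    good+bad≡size = trans (#good+#bad m) (sym size≡)
    bad≤1/d : frac (#bad m) t ≤ frac 1 d
    bad≤1/d = frac-≤⇐ (#bad m) t 1 d
      (subst₂ ℕ._≤_ (*-comm (suc d) (#bad m)) (trans (sym size≡) (sym (*-identityˡ (suc t)))) few-bad)

open Fractions using (frac; frac-positive; unit-fraction-below; ≤-scaled⇒)
open Counting using (module SampleSpace)
open Probability using (probability⇒many-good; few-bad⇒high-probability)

lemmaA1 : (M M' : ℕ → ℕ) → (s : ℕ) → s ≥ⁿ 1
    -- M' = ω(M):  M(B) / M'(B) → 0
    → (∀ (ε : ℚ) → 0ℚ < ε → ∃ λ B₀ → ∀ B → B ≥ⁿ B₀ → toℚ (M B) ≤ ε * toℚ (M' B))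
    -- Pr[max load of M(B) balls in B bins ≥ s] bounded away from 0
    → (∃ λ (c : ℚ) → 0ℚ < c × (∃ λ B₀ → ∀ B → B ≥ⁿ B₀ → c ≤ probMaxLoadAtLeast (M B) B s))
    -- then Pr[max load of M'(B) balls in B bins ≥ s] → 1
    → ∀ (ε : ℚ) → 0ℚ < ε → ∃ λ B₀ → ∀ B → B ≥ⁿ B₀ → 1ℚ - ε ≤ probMaxLoadAtLeast (M' B) B s
lemmaA1 M M' s _ M'≫M (c , c>0 , B₀ , c≤Pr) ε ε>0 = suc (B₀ ⊔ B₁) , large-B
  where
  -- c ≥ 1/(x+1) and ε ≥ 1/(d+1)
  x d : ℕ
  x = proj₁ (unit-fraction-below c c>0)
  d = proj₁ (unit-fraction-below ε ε>0)
  -- K + 1 = (d + 1)(x + 1), and M' B ≥ (K + 1) M B for B ≥ B₁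
  K B₁ : ℕ
  K = x ℕ.+ d ℕ.* suc x
  B₁ = proj₁ (M'≫M (frac 1 K) (frac-positive K))
  -- for B = b + 1 > B₀ ⊔ B₁ there is at least one bin and both hypotheses apply
  large-B : ∀ B → B ≥ⁿ suc (B₀ ⊔ B₁) → 1ℚ - ε ≤ probMaxLoadAtLeast (M' B) B s
  large-B (suc b) (s≤s b≥) =
    few-bad⇒high-probability b s {M' (suc b)} {d} {ε} (proj₂ (unit-fraction-below ε ε>0))
      (bad-fraction-decays x (suc d) enough-good many-balls)
    where
    open SampleSpace (suc b) using (module Threshold)
    open Threshold s using (#good; bad-fraction-decays)
    enough-good : suc b ℕ.^ M (suc b) ℕ.≤ #good (M (suc b)) ℕ.* suc x
    enough-good = probability⇒many-good b s {M (suc b)} {x}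
      (ℚ.≤-trans (proj₂ (unit-fraction-below c c>0)) (c≤Pr (suc b) (≤-trans (m≤m⊔n B₀ B₁) (≤-trans b≥ (n≤1+n b)))))
    many-balls : suc d ℕ.* suc x ℕ.* M (suc b) ℕ.≤ M' (suc b)
    many-balls = ≤-scaled⇒ {K} {M (suc b)} {M' (suc b)}
      (proj₂ (M'≫M (frac 1 K) (frac-positive K)) (suc b) (≤-trans (m≤n⊔m B₀ B₁) (≤-trans b≥ (n≤1+n b))))
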